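{- Let $\mathcal{P}\subseteq\mathcal{F}$ be a finite set of feasible paths, and let $\mathtt{OPT}_{\mathcal{P}}=\min\{\|\mathbf{y}\|:\mathbf{y}\in\mathbb{Z}_{\ge0}^E,\ \mathbf{y}\le\mathtt{b},\ \mathtt{D}(\mathcal{P},\mathbf{y})=|\mathcal{P}|\mathtt{T}\}$ be the minimum budget blocking all paths of $\mathcal{P}$. The Iterative Greedy algorithm (IG) — start with $\mathbf{x}=\mathbf{0}$ and, while $\mathtt{D}(\mathcal{P},\mathbf{x})<|\mathcal{P}|\mathtt{T}$, replace $\mathbf{x}$ by $\mathbf{x}+\mathbf{s}$ where $\mathbf{s}$ is a unit vector maximizing $\mathtt{D}(\mathcal{P},\mathbf{x}+\mathbf{s})-\mathtt{D}(\mathcal{P},\mathbf{x})$ — returns a vector $\mathbf{x}$ blocking all paths of $\mathcal{P}$ with $$\|\mathbf{x}\| = O\big(\gamma^{ -1}(\mathtt{h}\ln n+\ln\mathtt{T})\big)\cdot\mathtt{OPT}_{\mathcal{P}},$$ i.e. within a factor $O(\gamma^{ -1}(\mathtt{h}\ln n+\ln\mathtt{T}))$ of the optimal solution for blocking all paths in $\mathcal{P}$.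
   Context: Let $G=(V,E)$ be a directed graph with $n$ vertices. Each edge $e$ has a monotonically increasing weight function $f_e:\mathbb{Z}_{\ge0}\to\mathbb{Z}_{>0}$; $\mathtt{w}=\min_e f_e(0)>0$. A box $\mathtt{b}\in\mathbb{Z}_{\ge0}^E$, a set $S$ of vertex pairs $(s_i,t_i)$ and an integer threshold $\mathtt{T}$ are given; $\mathtt{h}=\lceil \mathtt{T}/\mathtt{w}\rceil$. Budget vectors are $\mathbf{x}\in\mathbb{Z}_{\ge0}^E$, $\|\mathbf{x}\|=\sum_e x_e$, compared componentwise; a unit vector has a single entry $1$ and all others $0$. A feasible path is a single (vertex-simple) directed path from $s_i$ to $t_i$ for some $(s_i,t_i)\in S$ with $\sum_{e\in p}f_e(0)<\mathtt{T}$; $\mathcal{F}$ is the set of feasible paths. For a path $p$, $\mathtt{r}(p,\mathbf{x})=\min(\mathtt{T},\sum_{e\in p}f_e(x_e))$, and $\mathtt{D}(\mathcal{P},\mathbf{x})=\sum_{p\in\mathcal{P}}\mathtt{r}(p,\mathbf{x})$; $\mathbf{x}$ blocks all paths of $\mathcal{P}$ iff $\mathtt{D}(\mathcal{P},\mathbf{x})=|\mathcal{P}|\mathtt{T}$. The concave ratio $\gamma$ is the largest $\gamma\in[0,1]$ with $f_e(x+1)-f_e(x)\ge\gamma(f_e(y+1)-f_e(y))$ for all $e$ and integers $0\le x\le y$. The $O(\cdot)$ hides an absolute constant. -}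

module Defs where

open import Data.Nat using (ℕ; zero; suc; _+_; _*_; _∸_; _⊓_; _≤_; _<_)
open import Data.Nat.ListAction using (sum)
open import Data.Fin using (Fin; _≟_)
open import Data.List using (List; []; _∷_; map; allFin; length)
open import Data.List.Membership.Propositional using (_∈_)
open import Data.List.Relation.Unary.Unique.Propositional using (Unique)
open import Data.Product using (_×_; _,_; ∃-syntax)
open import Relation.Nullary using (yes; no)
open import Relation.Binary.PropositionalEquality using (_≡_)

-- A directed graph: vertices Fin n, edges Fin m, edge e goes from src e to tgt e.
-- A path is given by its list of edges.

module _ {n m : ℕ} (src tgt : Fin m → Fin n) where

  Walk : Fin n → Fin n → List (Fin m) → Set
  Walk u v []       = u ≡ v
  Walk u v (e ∷ es) = src e ≡ u × Walk (tgt e) v es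

  verts : Fin n → List (Fin m) → List (Fin n)
  verts u []       = u ∷ []
  verts u (e ∷ es) = u ∷ verts (tgt e) es

  SimplePath : Fin n → Fin n → List (Fin m) → Set
  SimplePath u v es = Walk u v es × Unique (verts u es)

Budget : ℕ → Set
Budget m = Fin m → ℕ

zeroB : ∀ {m} → Budget m
zeroB _ = 0

‖_‖ : ∀ {m} → Budget m → ℕ
‖_‖ {m} x = sum (map x (allFin m))

unit : ∀ {m} → Fin m → Budget m
unit e e' with e' ≟ e
... | yes _ = 1
... | no  _ = 0

_⊕_ : ∀ {m} → Budget m → Budget m → Budget m
(x ⊕ y) e = x e + y e

pathLen : ∀ {m} → (Fin m → ℕ → ℕ) → Budget m → List (Fin m) → ℕ
pathLen f x p = sum (map (λ e → f e (x e)) p)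

rr : ∀ {m} → ℕ → (Fin m → ℕ → ℕ) → List (Fin m) → Budget m → ℕ
rr T f p x = T ⊓ pathLen f x p

DD : ∀ {m} → ℕ → (Fin m → ℕ → ℕ) → List (List (Fin m)) → Budget m → ℕ
DD T f P x = sum (map (λ p → rr T f p x) P)

Blocks : ∀ {m} → ℕ → (Fin m → ℕ → ℕ) → List (List (Fin m)) → Budget m → Set
Blocks T f P x = DD T f P x ≡ length P * T

Feasible : ∀ {n m} → (src tgt : Fin m → Fin n) → (Fin m → ℕ → ℕ) → ℕ →
           List (Fin n × Fin n) → List (Fin m) → Set
Feasible src tgt f T S p =
  ∃[ s ] ∃[ t ] ((s , t) ∈ S × SimplePath src tgt s t p × pathLen f zeroB p < T)

-- IGRun T f P x : x is a vector reachable by the Iterative Greedy algorithm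
-- (some run, with arbitrary tie-breaking), i.e. x = 0 or x = x' + s where x' is
-- reachable, D(P,x') < |P| T, and the unit vector s maximises D(P,x'+s) - D(P,x').
data IGRun {m : ℕ} (T : ℕ) (f : Fin m → ℕ → ℕ) (P : List (List (Fin m))) : Budget m → Set where
  start : IGRun T f P zeroB
  step  : ∀ {x} (e : Fin m) → IGRun T f P x →
          DD T f P x < length P * T →
          (∀ e' → DD T f P (x ⊕ unit e') ∸ DD T f P x ≤ DD T f P (x ⊕ unit e) ∸ DD T f P x) →
          IGRun T f P (x ⊕ unit e)

module Submission where

-- Write D = D(P,·), A = γd‖y‖ for a blocking budget y, and Δ(x) = |P|T − D(x)
-- for the deficit of x.  The argument has three ingredients.
--  * Weak diminishing returns: each f_e has concave ratio γ = γn/γd, hence so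
--    do path lengths, their truncations min(T,·), and D.  Adding y to x unit by
--    unit therefore gains at most ‖y‖·γ⁻¹·g, where g is the best marginal gain at x;
--    since x + y blocks P, the greedy gain g is at least γΔ(x)/‖y‖, so
--    Δ(x + s)·A ≤ Δ(x)·(A − γn) along every IG step.
--  * Geometric decay: A^j ≤ Δ(0)(A − γn)^j with Δ(0) ≤ 2^Q forces
--    j·γn ≤ 2(Q+1)A (a Bernoulli-type estimate: every ⌊A/γn⌋ + 1 steps halve).
--  * Counting: feasible paths have fewer than h edges and the graph is simple,
--    so |P| ≤ (m+1)^h ≤ 2^(3h⌈log₂ n⌉) and Δ(0) ≤ |P|T ≤ 2^(3h⌈log₂ n⌉ + ⌈log₂ T⌉).
-- Combining the three gives the theorem with the constant C = 10.

open import Defs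
open import Data.Nat hiding (_≟_)
open import Data.Nat.Properties hiding (_≟_)
open import Data.Nat.DivMod using (_/_; _%_; m≡m%n+[m/n]*n; m%n<n; m/n*n≤m)
open import Data.Nat.ListAction using (sum)
open import Data.Nat.Logarithm using (⌈log₂_⌉)
open import Data.Nat.Logarithm.Core using (⌈log2⌉)
open import Data.Nat.Induction using (<-wellFounded)
open import Induction.WellFounded using (Acc; acc)
open import Data.Fin using (Fin; zero; suc; _≟_; combine)
open import Data.Fin.Properties using (injective⇒≤; combine-injective) renaming (suc-injective to Fin-suc-injective)
open import Data.List using (List; []; _∷_; map; allFin; length; lookup; _++_; concatMap; replicate; cartesianProductWith)
open import Data.List.Properties using (map-cong; map-tabulate; length-++; length-map; length-replicate; length-tabulate)
open import Data.List.Relation.Unary.All using (All; []; _∷_)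
import Data.List.Relation.Unary.All as All
open import Data.List.Relation.Unary.Any using (here; there; index)
open import Data.List.Relation.Unary.Any.Properties using (lookup-index)
open import Data.List.Relation.Unary.AllPairs using (_∷_)
open import Data.List.Relation.Unary.Unique.Propositional using (Unique)
open import Data.List.Membership.Propositional using (_∈_)
open import Data.List.Membership.Propositional.Properties using (∈-lookup; ∈-allFin; ∈-cartesianProductWith⁺)
open import Data.Product using (_×_; _,_; ∃-syntax)
open import Relation.Nullary using (Dec; yes; no; contradiction)
open import Relation.Binary.PropositionalEquality
open import Algebra.Properties.CommutativeSemigroup +-commutativeSemigroup
  using () renaming (interchange to +-interchange)
open import Algebra.Properties.CommutativeSemigroup *-commutativeSemigroup
  using () renaming (x∙yz≈y∙xz to *-leftComm; interchange to *-interchange)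
open import Data.Nat.Solver using (module +-*-Solver)
open +-*-Solver using (solve; _:=_; con; _:+_; _:*_)

+-∸-interchange : ∀ {a b c d} → c ≤ a → d ≤ b → (a + b) ∸ (c + d) ≡ (a ∸ c) + (b ∸ d)
+-∸-interchange {a} {b} {c} {d} c≤a d≤b = begin
  (a + b) ∸ (c + d)     ≡⟨ sym (∸-+-assoc (a + b) c d) ⟩
  (a + b) ∸ c ∸ d       ≡⟨ cong (_∸ d) (+-∸-comm b c≤a) ⟩
  ((a ∸ c) + b) ∸ d     ≡⟨ +-∸-assoc (a ∸ c) d≤b ⟩
  (a ∸ c) + (b ∸ d)     ∎
  where open ≡-Reasoning

module _ {A : Set} where

  sum-map-cong : (F G : A → ℕ) (l : List A) → (∀ a → F a ≡ G a) → sum (map F l) ≡ sum (map G l)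
  sum-map-cong F G l F≗G = cong sum (map-cong F≗G l)

  sum-map-zero : (F : A → ℕ) (l : List A) → (∀ a → F a ≡ 0) → sum (map F l) ≡ 0
  sum-map-zero F []      F≗0 = refl
  sum-map-zero F (a ∷ l) F≗0 = cong₂ _+_ (F≗0 a) (sum-map-zero F l F≗0)

  sum-map-+ : (F G : A → ℕ) (l : List A) →
              sum (map (λ a → F a + G a) l) ≡ sum (map F l) + sum (map G l)
  sum-map-+ F G []      = refl
  sum-map-+ F G (a ∷ l) = trans (cong (F a + G a +_) (sum-map-+ F G l))
                                (+-interchange (F a) (G a) (sum (map F l)) (sum (map G l)))

  sum-map-*ˡ : (c : ℕ) (F : A → ℕ) (l : List A) → sum (map (λ a → c * F a) l) ≡ c * sum (map F l)
  sum-map-*ˡ c F []      = sym (*-zeroʳ c)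
  sum-map-*ˡ c F (a ∷ l) = trans (cong (c * F a +_) (sum-map-*ˡ c F l))
                                 (sym (*-distribˡ-+ c (F a) (sum (map F l))))

  sum-map-mono : (F G : A → ℕ) (l : List A) → (∀ a → F a ≤ G a) → sum (map F l) ≤ sum (map G l)
  sum-map-mono F G []      F≤G = z≤n
  sum-map-mono F G (a ∷ l) F≤G = +-mono-≤ (F≤G a) (sum-map-mono F G l F≤G)

  sum-map-∸ : (F G : A → ℕ) (l : List A) → (∀ a → G a ≤ F a) →
              sum (map F l) ∸ sum (map G l) ≡ sum (map (λ a → F a ∸ G a) l)
  sum-map-∸ F G []      G≤F = refl
  sum-map-∸ F G (a ∷ l) G≤F =
    trans (+-∸-interchange (G≤F a) (sum-map-mono G F l G≤F)) (cong (F a ∸ G a +_) (sum-map-∸ F G l G≤F))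

n≤2^⌈log₂n⌉ : ∀ n → n ≤ 2 ^ ⌈log₂ n ⌉
n≤2^⌈log₂n⌉ n = go n (<-wellFounded n)
  where
  open ≤-Reasoning
  go : ∀ n (rec : Acc _<_ n) → n ≤ 2 ^ ⌈log2⌉ n rec
  go zero          _         = z≤n
  go (suc zero)    _         = s≤s z≤n
  go (suc (suc n)) (acc rec) = begin
    2 + n                      ≡⟨ cong (2 +_) (sym (⌊n/2⌋+⌈n/2⌉≡n n)) ⟩
    2 + (⌊ n /2⌋ + ⌈ n /2⌉)    ≤⟨ +-monoʳ-≤ 2 (+-monoˡ-≤ ⌈ n /2⌉ (⌊n/2⌋≤⌈n/2⌉ n)) ⟩
    2 + (⌈ n /2⌉ + ⌈ n /2⌉)    ≡⟨ solve 1 (λ k → con 2 :+ (k :+ k) := con 2 :* (con 1 :+ k)) refl ⌈ n /2⌉ ⟩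
    2 * suc ⌈ n /2⌉            ≤⟨ *-monoʳ-≤ 2 (go (suc ⌈ n /2⌉) (rec (⌈n/2⌉<n n))) ⟩
    2 * 2 ^ ⌈log2⌉ (suc ⌈ n /2⌉) (rec (⌈n/2⌉<n n)) ∎

-- Bernoulli's inequality in product form: with A = c + d,
-- d^t (A + t c) ≤ A^(t+1), i.e. (1 − c/A)^t (1 + t c/A) ≤ 1.
bernoulli : ∀ c d t → d ^ t * ((c + d) + t * c) ≤ (c + d) ^ suc t
bernoulli c d zero    = ≤-reflexive (solve 2 (λ c d → con 1 :* ((c :+ d) :+ con 0 :* c) := (c :+ d) :* con 1) refl c d)
bernoulli c d (suc t) = begin
  d ^ suc t * (A + suc t * c)   ≡⟨ *-assoc d (d ^ t) _ ⟩
  d * (d ^ t * (A + suc t * c)) ≡⟨ *-leftComm d (d ^ t) _ ⟩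
  d ^ t * (d * (A + suc t * c)) ≤⟨ *-monoʳ-≤ (d ^ t) oneStep ⟩
  d ^ t * (A * (A + t * c))     ≡⟨ *-leftComm (d ^ t) A _ ⟩
  A * (d ^ t * (A + t * c))     ≤⟨ *-monoʳ-≤ A (bernoulli c d t) ⟩
  A * A ^ suc t                 ∎
  where
  open ≤-Reasoning
  A : ℕ
  A = c + d
  -- replacing a factor A by d loses exactly c (c + t c)
  oneStep : d * (A + suc t * c) ≤ A * (A + t * c)
  oneStep = subst (d * (A + suc t * c) ≤_)
    (solve 3 (λ c d t → d :* ((c :+ d) :+ (con 1 :+ t) :* c) :+ c :* (c :+ t :* c)
                        := (c :+ d) :* ((c :+ d) :+ t :* c)) refl c d t)
    (m≤m+n (d * (A + suc t * c)) (c * (c + t * c)))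

halving : ∀ c d t .{{_ : NonZero c}} → c + d ≤ t * c → 2 * d ^ t ≤ (c + d) ^ t
halving c@(suc _) d t A≤tc = *-cancelʳ-≤ (2 * d ^ t) (A ^ t) A (begin
  2 * d ^ t * A       ≡⟨ solve 2 (λ X A → con 2 :* X :* A := X :* (A :+ A)) refl (d ^ t) A ⟩
  d ^ t * (A + A)     ≤⟨ *-monoʳ-≤ (d ^ t) (+-monoʳ-≤ A A≤tc) ⟩
  d ^ t * (A + t * c) ≤⟨ bernoulli c d t ⟩
  A * A ^ t           ≡⟨ *-comm A (A ^ t) ⟩
  A ^ t * A           ∎)
  where
  open ≤-Reasoning
  A : ℕ
  A = c + d

iteratedHalving : ∀ c d t .{{_ : NonZero c}} → c + d ≤ t * c →
                  ∀ q r → 2 ^ q * d ^ (q * t + r) ≤ (c + d) ^ (q * t + r)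
iteratedHalving c d t A≤tc zero    r = ≤-trans (≤-reflexive (+-identityʳ (d ^ r))) (^-monoˡ-≤ r (m≤n+m d c))
iteratedHalving c d t A≤tc (suc q) r = begin
  2 ^ suc q * d ^ (suc q * t + r)           ≡⟨ cong (λ k → 2 ^ suc q * d ^ k) (+-assoc t (q * t) r) ⟩
  2 * 2 ^ q * d ^ (t + (q * t + r))         ≡⟨ cong (2 * 2 ^ q *_) (^-distribˡ-+-* d t (q * t + r)) ⟩
  2 * 2 ^ q * (d ^ t * d ^ (q * t + r))     ≡⟨ *-interchange 2 (2 ^ q) (d ^ t) (d ^ (q * t + r)) ⟩
  2 * d ^ t * (2 ^ q * d ^ (q * t + r))     ≤⟨ *-mono-≤ (halving c d t A≤tc) (iteratedHalving c d t A≤tc q r) ⟩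
  A ^ t * A ^ (q * t + r)                   ≡⟨ sym (^-distribˡ-+-* A t (q * t + r)) ⟩
  A ^ (t + (q * t + r))                     ≡⟨ cong (A ^_) (sym (+-assoc t (q * t) r)) ⟩
  A ^ (suc q * t + r)                       ∎
  where
  open ≤-Reasoning
  A : ℕ
  A = c + d

-- Indeed every t = ⌊A/c⌋ + 1 steps halve,
-- so at most Q + 1 blocks of t steps fit, and t c ≤ A + A.
decayLength : ∀ c d D j Q .{{_ : NonZero c}} → (c + d) ^ j ≤ D * d ^ j → D ≤ 2 ^ Q →
              j * c ≤ suc Q * ((c + d) + (c + d))
decayLength c@(suc _) d D j Q decay D≤2^Q = <⇒≤ (begin-strict
  j * c                  <⟨ *-monoˡ-< c j<[q+1]t ⟩
  suc q * t * c          ≡⟨ *-assoc (suc q) t c ⟩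
  suc q * (t * c)        ≤⟨ *-mono-≤ (s≤s q≤Q) tc≤A+A ⟩
  suc Q * (A + A)        ∎)
  where
  open ≤-Reasoning
  A : ℕ
  A = c + d
  t : ℕ
  t = suc (A / c)
  q : ℕ
  q = j / t
  r : ℕ
  r = j % t
  tc≤A+A : t * c ≤ A + A
  tc≤A+A = +-mono-≤ (m≤m+n c d) (m/n*n≤m A c)
  A≤tc : A ≤ t * c
  A≤tc = begin
    A                 ≡⟨ m≡m%n+[m/n]*n A c ⟩
    A % c + A / c * c ≤⟨ +-monoˡ-≤ (A / c * c) (<⇒≤ (m%n<n A c)) ⟩
    c + A / c * c     ∎
  j≡qt+r : j ≡ q * t + r
  j≡qt+r = trans (m≡m%n+[m/n]*n j t) (+-comm r (q * t))
  j<[q+1]t : j < suc q * t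
  j<[q+1]t = begin-strict
    j         ≡⟨ trans j≡qt+r (+-comm (q * t) r) ⟩
    r + q * t <⟨ +-monoˡ-< (q * t) (m%n<n j t) ⟩
    t + q * t ∎
  2^q*A^j≤D*A^j : 2 ^ q * A ^ j ≤ D * A ^ j
  2^q*A^j≤D*A^j = begin
    2 ^ q * A ^ j       ≤⟨ *-monoʳ-≤ (2 ^ q) decay ⟩
    2 ^ q * (D * d ^ j) ≡⟨ *-leftComm (2 ^ q) D (d ^ j) ⟩
    D * (2 ^ q * d ^ j) ≤⟨ *-monoʳ-≤ D (subst (λ k → 2 ^ q * d ^ k ≤ A ^ k) (sym j≡qt+r) (iteratedHalving c d t A≤tc q r)) ⟩
    D * A ^ j           ∎
  2^q≤D : 2 ^ q ≤ D
  2^q≤D = *-cancelʳ-≤ (2 ^ q) D (A ^ j) {{m^n≢0 A j}} 2^q*A^j≤D*A^j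
  q≤Q : q ≤ Q
  q≤Q = ≮⇒≥ (λ Q<q → <⇒≱ (^-monoʳ-< 2 (s≤s (s≤s z≤n)) Q<q) (≤-trans 2^q≤D D≤2^Q))

unit-same : ∀ {m} (e : Fin m) → unit e e ≡ 1
unit-same e with e ≟ e
... | yes _   = refl
... | no e≢e = contradiction refl e≢e

unit-diff : ∀ {m} {e e' : Fin m} → e' ≢ e → unit e e' ≡ 0
unit-diff {e = e} {e'} e'≢e with e' ≟ e
... | yes e'≡e = contradiction e'≡e e'≢e
... | no _     = refl

unit-sym : ∀ {m} (e e' : Fin m) → unit e e' ≡ unit e' e
unit-sym e e' = by-cases (e' ≟ e)
  where
  by-cases : Dec (e' ≡ e) → unit e e' ≡ unit e' e
  by-cases (yes refl)  = refl
  by-cases (no e'≢e) = trans (unit-diff e'≢e) (sym (unit-diff (λ e≡e' → e'≢e (sym e≡e'))))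

unit-suc : ∀ {m} (e e' : Fin m) → unit (suc e) (suc e') ≡ unit e e'
unit-suc e e' = by-cases (e' ≟ e)
  where
  by-cases : Dec (e' ≡ e) → unit (suc e) (suc e') ≡ unit e e'
  by-cases (yes refl)  = trans (unit-same (suc e)) (sym (unit-same e))
  by-cases (no e'≢e) = trans (unit-diff (λ eq → e'≢e (Fin-suc-injective eq))) (sym (unit-diff e'≢e))

sum-allFin-suc : ∀ {m} (g : Fin (suc m) → ℕ) →
                 sum (map g (allFin (suc m))) ≡ g zero + sum (map (λ e → g (suc e)) (allFin m))
sum-allFin-suc {m} g =
  cong (λ l → g zero + sum l) (trans (map-tabulate suc g) (sym (map-tabulate (λ e → e) (λ e → g (suc e)))))

sum-unit : ∀ {m} (g : Fin m → ℕ) (e' : Fin m) → sum (map (λ e → g e * unit e e') (allFin m)) ≡ g e'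
sum-unit {suc m} g zero = begin
  sum (map (λ e → g e * unit e zero) (allFin (suc m)))                 ≡⟨ sum-allFin-suc (λ e → g e * unit e zero) ⟩
  g zero * 1 + sum (map (λ e → g (suc e) * unit (suc e) zero) (allFin m))
    ≡⟨ cong₂ _+_ (*-identityʳ (g zero)) (sum-map-zero _ (allFin m) (λ e → *-zeroʳ (g (suc e)))) ⟩
  g zero + 0                                                           ≡⟨ +-identityʳ (g zero) ⟩
  g zero                                                               ∎
  where open ≡-Reasoning
sum-unit {suc m} g (suc e') = begin
  sum (map (λ e → g e * unit e (suc e')) (allFin (suc m)))             ≡⟨ sum-allFin-suc (λ e → g e * unit e (suc e')) ⟩
  g zero * 0 + sum (map (λ e → g (suc e) * unit (suc e) (suc e')) (allFin m))
    ≡⟨ cong₂ _+_ (*-zeroʳ (g zero)) (sum-map-cong _ _ (allFin m) (λ e → cong (g (suc e) *_) (unit-suc e e'))) ⟩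
  sum (map (λ e → g (suc e) * unit e e') (allFin m))                   ≡⟨ sum-unit (λ e → g (suc e)) e' ⟩
  g (suc e')                                                           ∎
  where open ≡-Reasoning

norm-zero : ∀ {m} → ‖ zeroB {m} ‖ ≡ 0
norm-zero {m} = sum-map-zero zeroB (allFin m) (λ _ → refl)

norm-⊕-unit : ∀ {m} (x : Budget m) (e : Fin m) → ‖ x ⊕ unit e ‖ ≡ suc ‖ x ‖
norm-⊕-unit {m} x e = begin
  ‖ x ⊕ unit e ‖                                   ≡⟨ sum-map-+ x (unit e) (allFin m) ⟩
  ‖ x ‖ + ‖ unit e ‖                               ≡⟨ cong (‖ x ‖ +_) (sum-map-cong _ _ (allFin m) unit-as-weight) ⟩
  ‖ x ‖ + sum (map (λ e' → 1 * unit e' e) (allFin m)) ≡⟨ cong (‖ x ‖ +_) (sum-unit (λ _ → 1) e) ⟩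
  ‖ x ‖ + 1                                        ≡⟨ +-comm ‖ x ‖ 1 ⟩
  suc ‖ x ‖                                        ∎
  where
  open ≡-Reasoning
  unit-as-weight : ∀ e' → unit e e' ≡ 1 * unit e' e
  unit-as-weight e' = trans (unit-sym e e') (sym (*-identityˡ (unit e' e)))

_≤B_ : ∀ {m} → Budget m → Budget m → Set
x ≤B z = ∀ e → x e ≤ z e

≤B-⊕ : ∀ {m} (x z : Budget m) → x ≤B (x ⊕ z)
≤B-⊕ x z e = m≤m+n (x e) (z e)

_⊕units_ : ∀ {m} → Budget m → List (Fin m) → Budget m
x ⊕units []      = x
x ⊕units (e ∷ L) = (x ⊕units L) ⊕ unit e

⊕units-≥ : ∀ {m} (x : Budget m) L → x ≤B (x ⊕units L)
⊕units-≥ x []      e' = ≤-refl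
⊕units-≥ x (e ∷ L) e' = ≤-trans (⊕units-≥ x L e') (m≤m+n _ (unit e e'))

⊕units-++ : ∀ {m} (x : Budget m) (L₁ L₂ : List (Fin m)) → x ⊕units (L₁ ++ L₂) ≡ (x ⊕units L₂) ⊕units L₁
⊕units-++ x []       L₂ = refl
⊕units-++ x (e ∷ L₁) L₂ = cong (_⊕ unit e) (⊕units-++ x L₁ L₂)

⊕units-replicate : ∀ {m} (x : Budget m) k (e e' : Fin m) → (x ⊕units replicate k e) e' ≡ x e' + k * unit e e'
⊕units-replicate x zero    e e' = sym (+-identityʳ (x e'))
⊕units-replicate x (suc k) e e' = begin
  (x ⊕units replicate k e) e' + unit e e' ≡⟨ cong (_+ unit e e') (⊕units-replicate x k e e') ⟩
  x e' + k * unit e e' + unit e e'        ≡⟨ +-assoc (x e') (k * unit e e') (unit e e') ⟩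
  x e' + (k * unit e e' + unit e e')      ≡⟨ cong (x e' +_) (+-comm (k * unit e e') (unit e e')) ⟩
  x e' + suc k * unit e e'                ∎
  where open ≡-Reasoning

-- Every budget is a sum of unit vectors: atoms y lists each edge e exactly y e times,
-- so it has ‖y‖ entries and adding them to x yields x + y.
atoms : ∀ {m} → Budget m → List (Fin m)
atoms {m} y = concatMap (λ e → replicate (y e) e) (allFin m)

length-atoms : ∀ {m} (y : Budget m) → length (atoms y) ≡ ‖ y ‖
length-atoms {m} y = go (allFin m)
  where
  go : ∀ es → length (concatMap (λ e → replicate (y e) e) es) ≡ sum (map y es)
  go []       = refl
  go (e ∷ es) = trans (length-++ (replicate (y e) e)) (cong₂ _+_ (length-replicate (y e)) (go es))

⊕units-atoms : ∀ {m} (x y : Budget m) e' → (x ⊕units atoms y) e' ≡ x e' + y e'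
⊕units-atoms {m} x y e' = trans (go (allFin m)) (cong (x e' +_) (sum-unit y e'))
  where
  open ≡-Reasoning
  go : ∀ es → (x ⊕units concatMap (λ e → replicate (y e) e) es) e' ≡ x e' + sum (map (λ e → y e * unit e e') es)
  go []       = sym (+-identityʳ (x e'))
  go (e ∷ es) = begin
    (x ⊕units (replicate (y e) e ++ rest)) e'        ≡⟨ cong (λ z → z e') (⊕units-++ x (replicate (y e) e) rest) ⟩
    ((x ⊕units rest) ⊕units replicate (y e) e) e'    ≡⟨ ⊕units-replicate (x ⊕units rest) (y e) e e' ⟩
    (x ⊕units rest) e' + y e * unit e e'             ≡⟨ cong (_+ y e * unit e e') (go es) ⟩
    x e' + S + y e * unit e e'                       ≡⟨ +-assoc (x e') S (y e * unit e e') ⟩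
    x e' + (S + y e * unit e e')                     ≡⟨ cong (x e' +_) (+-comm S (y e * unit e e')) ⟩
    x e' + (y e * unit e e' + S)                     ∎
    where
    rest : List (Fin m)
    rest = concatMap (λ e → replicate (y e) e) es
    S : ℕ
    S = sum (map (λ e → y e * unit e e') es)

⊓-gain : ∀ T a d → T ⊓ (a + d) ∸ T ⊓ a ≡ (T ∸ a) ⊓ d
⊓-gain zero    a       d = cong (_⊓ d) (sym (0∸n≡0 a))
⊓-gain (suc T) zero    d = refl
⊓-gain (suc T) (suc a) d = ⊓-gain T a d

module Coverage {m : ℕ} (T : ℕ) (f : Fin m → ℕ → ℕ) (f-mono : ∀ e x y → x ≤ y → f e x ≤ f e y) where

  δ : Fin m → ℕ → ℕ
  δ e v = f e (suc v) ∸ f e v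

  count : Fin m → List (Fin m) → ℕ
  count e p = sum (map (unit e) p)

  DD-cong : ∀ {x z : Budget m} → (∀ e → x e ≡ z e) → ∀ P → DD T f P x ≡ DD T f P z
  DD-cong x≗z P = sum-map-cong _ _ P (λ p → cong (T ⊓_) (sum-map-cong _ _ p (λ e → cong (f e) (x≗z e))))

  pathLen-mono : ∀ {x z : Budget m} → x ≤B z → ∀ p → pathLen f x p ≤ pathLen f z p
  pathLen-mono x≤z p = sum-map-mono _ _ p (λ e → f-mono e _ _ (x≤z e))

  rr-mono : ∀ {x z : Budget m} → x ≤B z → ∀ p → rr T f p x ≤ rr T f p z
  rr-mono x≤z p = ⊓-monoʳ-≤ T (pathLen-mono x≤z p)

  DD-mono : ∀ {x z : Budget m} → x ≤B z → ∀ P → DD T f P x ≤ DD T f P z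
  DD-mono x≤z P = sum-map-mono _ _ P (rr-mono x≤z)

  DD-max : ∀ (x : Budget m) P → DD T f P x ≤ length P * T
  DD-max x []      = z≤n
  DD-max x (p ∷ P) = +-mono-≤ (m⊓n≤m T _) (DD-max x P)

  blocked-head : ∀ (y : Budget m) p P → Blocks T f (p ∷ P) y → T ≤ pathLen f y p
  blocked-head y p P blocks = ≤-trans T≤rr (m⊓n≤n T (pathLen f y p))
    where
    T≤rr : T ≤ rr T f p y
    T≤rr = ≮⇒≥ (λ rr<T → <-irrefl blocks (+-mono-<-≤ rr<T (DD-max y P)))

  f-⊕-unit : ∀ (x : Budget m) e e' → f e' (x e' + unit e e') ≡ f e' (x e') + δ e (x e) * unit e e'
  f-⊕-unit x e e' = by-cases (e' ≟ e)
    where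
    open ≡-Reasoning
    by-cases : Dec (e' ≡ e) → f e' (x e' + unit e e') ≡ f e' (x e') + δ e (x e) * unit e e'
    by-cases (yes refl) = begin
      f e (x e + unit e e)          ≡⟨ cong (λ k → f e (x e + k)) (unit-same e) ⟩
      f e (x e + 1)                 ≡⟨ cong (f e) (+-comm (x e) 1) ⟩
      f e (suc (x e))               ≡⟨ sym (m+[n∸m]≡n (f-mono e _ _ (n≤1+n (x e)))) ⟩
      f e (x e) + δ e (x e)         ≡⟨ cong (f e (x e) +_) (trans (cong (δ e (x e) *_) (unit-same e)) (*-identityʳ _)) ⟨
      f e (x e) + δ e (x e) * unit e e ∎
    by-cases (no e'≢e) = begin
      f e' (x e' + unit e e')               ≡⟨ cong (λ k → f e' (x e' + k)) (unit-diff e'≢e) ⟩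
      f e' (x e' + 0)                       ≡⟨ cong (f e') (+-identityʳ (x e')) ⟩
      f e' (x e')                           ≡⟨ +-identityʳ (f e' (x e')) ⟨
      f e' (x e') + 0                       ≡⟨ cong (λ k → f e' (x e') + k) (trans (cong (δ e (x e) *_) (unit-diff e'≢e)) (*-zeroʳ (δ e (x e)))) ⟨
      f e' (x e') + δ e (x e) * unit e e'   ∎

  pathLen-⊕-unit : ∀ (x : Budget m) e p → pathLen f (x ⊕ unit e) p ≡ pathLen f x p + δ e (x e) * count e p
  pathLen-⊕-unit x e p = begin
    pathLen f (x ⊕ unit e) p                                     ≡⟨ sum-map-cong _ _ p (f-⊕-unit x e) ⟩
    sum (map (λ e' → f e' (x e') + δ e (x e) * unit e e') p)     ≡⟨ sum-map-+ _ _ p ⟩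
    pathLen f x p + sum (map (λ e' → δ e (x e) * unit e e') p)   ≡⟨ cong (pathLen f x p +_) (sum-map-*ˡ (δ e (x e)) (unit e) p) ⟩
    pathLen f x p + δ e (x e) * count e p                        ∎
    where open ≡-Reasoning

  module WeakDiminishingReturns (γn γd : ℕ) (γn≤γd : γn ≤ γd)
      (concave : ∀ e x y → x ≤ y → γn * (f e (suc y) ∸ f e y) ≤ γd * (f e (suc x) ∸ f e x)) where

    rr-weakDR : ∀ {x z : Budget m} → x ≤B z → ∀ e p →
      γn * (rr T f p (z ⊕ unit e) ∸ rr T f p z) ≤ γd * (rr T f p (x ⊕ unit e) ∸ rr T f p x)
    rr-weakDR {x} {z} x≤z e p = begin
      γn * (T ⊓ pathLen f (z ⊕ unit e) p ∸ T ⊓ lz)  ≡⟨ cong (λ l → γn * (T ⊓ l ∸ T ⊓ lz)) (pathLen-⊕-unit z e p) ⟩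
      γn * (T ⊓ (lz + δ e (z e) * k) ∸ T ⊓ lz)      ≡⟨ cong (γn *_) (⊓-gain T lz _) ⟩
      γn * ((T ∸ lz) ⊓ (δ e (z e) * k))            ≡⟨ *-distribˡ-⊓ γn (T ∸ lz) _ ⟩
      (γn * (T ∸ lz)) ⊓ (γn * (δ e (z e) * k))     ≤⟨ ⊓-mono-≤ (*-mono-≤ γn≤γd (∸-monoʳ-≤ T (pathLen-mono x≤z p))) increment ⟩
      (γd * (T ∸ lx)) ⊓ (γd * (δ e (x e) * k))     ≡⟨ *-distribˡ-⊓ γd (T ∸ lx) _ ⟨
      γd * ((T ∸ lx) ⊓ (δ e (x e) * k))            ≡⟨ cong (γd *_) (⊓-gain T lx _) ⟨
      γd * (T ⊓ (lx + δ e (x e) * k) ∸ T ⊓ lx)      ≡⟨ cong (λ l → γd * (T ⊓ l ∸ T ⊓ lx)) (pathLen-⊕-unit x e p) ⟨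
      γd * (T ⊓ pathLen f (x ⊕ unit e) p ∸ T ⊓ lx)  ∎
      where
      open ≤-Reasoning
      lx : ℕ
      lx = pathLen f x p
      lz : ℕ
      lz = pathLen f z p
      k : ℕ
      k = count e p
      increment : γn * (δ e (z e) * k) ≤ γd * (δ e (x e) * k)
      increment = begin
        γn * (δ e (z e) * k) ≡⟨ *-assoc γn (δ e (z e)) k ⟨
        γn * δ e (z e) * k   ≤⟨ *-monoˡ-≤ k (concave e (x e) (z e) (x≤z e)) ⟩
        γd * δ e (x e) * k   ≡⟨ *-assoc γd (δ e (x e)) k ⟩
        γd * (δ e (x e) * k) ∎

    DD-weakDR : ∀ {x z : Budget m} → x ≤B z → ∀ e P →
      γn * (DD T f P (z ⊕ unit e) ∸ DD T f P z) ≤ γd * (DD T f P (x ⊕ unit e) ∸ DD T f P x)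
    DD-weakDR {x} {z} x≤z e P = begin
      γn * (DD T f P (z ⊕ unit e) ∸ DD T f P z)                            ≡⟨ cong (γn *_) (sum-map-∸ _ _ P (rr-mono (≤B-⊕ z (unit e)))) ⟩
      γn * sum (map (λ p → rr T f p (z ⊕ unit e) ∸ rr T f p z) P)          ≡⟨ sum-map-*ˡ γn _ P ⟨
      sum (map (λ p → γn * (rr T f p (z ⊕ unit e) ∸ rr T f p z)) P)        ≤⟨ sum-map-mono _ _ P (rr-weakDR x≤z e) ⟩
      sum (map (λ p → γd * (rr T f p (x ⊕ unit e) ∸ rr T f p x)) P)        ≡⟨ sum-map-*ˡ γd _ P ⟩
      γd * sum (map (λ p → rr T f p (x ⊕ unit e) ∸ rr T f p x) P)          ≡⟨ cong (γd *_) (sum-map-∸ _ _ P (rr-mono (≤B-⊕ x (unit e)))) ⟨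
      γd * (DD T f P (x ⊕ unit e) ∸ DD T f P x)                            ∎
      where open ≤-Reasoning

    telescope : ∀ (x : Budget m) P g → (∀ e → DD T f P (x ⊕ unit e) ∸ DD T f P x ≤ g) →
                ∀ L → γn * (DD T f P (x ⊕units L) ∸ DD T f P x) ≤ length L * (γd * g)
    telescope x P g gain≤g [] = ≤-reflexive (trans (cong (γn *_) (n∸n≡0 (DD T f P x))) (*-zeroʳ γn))
    telescope x P g gain≤g (e ∷ L) = begin
      γn * (D₂ ∸ D₀)                     ≡⟨ cong (γn *_) D₀→D₂-split ⟩
      γn * ((D₂ ∸ D₁) + (D₁ ∸ D₀))       ≡⟨ *-distribˡ-+ γn (D₂ ∸ D₁) (D₁ ∸ D₀) ⟩
      γn * (D₂ ∸ D₁) + γn * (D₁ ∸ D₀)    ≤⟨ +-mono-≤ (≤-trans (DD-weakDR x≤z e P) (*-monoʳ-≤ γd (gain≤g e))) (telescope x P g gain≤g L) ⟩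
      γd * g + length L * (γd * g)       ∎
      where
      open ≤-Reasoning
      z : Budget m
      z = x ⊕units L
      D₀ : ℕ
      D₀ = DD T f P x
      D₁ : ℕ
      D₁ = DD T f P z
      D₂ : ℕ
      D₂ = DD T f P (z ⊕ unit e)
      x≤z : x ≤B z
      x≤z = ⊕units-≥ x L
      D₀→D₂-split : D₂ ∸ D₀ ≡ (D₂ ∸ D₁) + (D₁ ∸ D₀)
      D₀→D₂-split = trans (cong (_∸ D₀) (sym (m∸n+n≡m (DD-mono (≤B-⊕ z (unit e)) P))))
                          (+-∸-assoc (D₂ ∸ D₁) (DD-mono x≤z P))

    -- The greedy gain is large: if y blocks P and g bounds every marginal gain at x,
    -- then γn (|P| T − D(x)) ≤ ‖y‖ γd g, because D(x + y) = |P| T and x + y is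
    -- reached from x by the ‖y‖ unit steps of atoms y.
    deficit-bound : ∀ (x y : Budget m) P → Blocks T f P y → ∀ g →
                    (∀ e → DD T f P (x ⊕ unit e) ∸ DD T f P x ≤ g) →
                    γn * (length P * T ∸ DD T f P x) ≤ ‖ y ‖ * (γd * g)
    deficit-bound x y P blocks g gain≤g = begin
      γn * (length P * T ∸ DD T f P x)                ≤⟨ *-monoʳ-≤ γn (∸-monoˡ-≤ (DD T f P x) |P|T≤D[x+y]) ⟩
      γn * (DD T f P (x ⊕ y) ∸ DD T f P x)            ≡⟨ cong (λ D → γn * (D ∸ DD T f P x)) (DD-cong (λ e → sym (⊕units-atoms x y e)) P) ⟩
      γn * (DD T f P (x ⊕units atoms y) ∸ DD T f P x) ≤⟨ telescope x P g gain≤g (atoms y) ⟩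
      length (atoms y) * (γd * g)                     ≡⟨ cong (_* (γd * g)) (length-atoms y) ⟩
      ‖ y ‖ * (γd * g)                                ∎
      where
      open ≤-Reasoning
      |P|T≤D[x+y] : length P * T ≤ DD T f P (x ⊕ y)
      |P|T≤D[x+y] = subst (_≤ DD T f P (x ⊕ y)) blocks (DD-mono (λ e → m≤n+m (y e) (x e)) P)

    module Greedy (P : List (List (Fin m))) (y : Budget m) (blocks : Blocks T f P y) where

      A : ℕ
      A = γd * ‖ y ‖

      deficit : Budget m → ℕ
      deficit x = length P * T ∸ DD T f P x

      contraction : ∀ (x : Budget m) e →
        (∀ e' → DD T f P (x ⊕ unit e') ∸ DD T f P x ≤ DD T f P (x ⊕ unit e) ∸ DD T f P x) →
        deficit (x ⊕ unit e) * A ≤ deficit x * (A ∸ γn)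
      contraction x e greedy = begin
        deficit (x ⊕ unit e) * A        ≡⟨ cong (_* A) deficit-step ⟩
        (deficit x ∸ g) * A             ≡⟨ *-distribʳ-∸ A (deficit x) g ⟩
        deficit x * A ∸ g * A           ≤⟨ ∸-monoʳ-≤ (deficit x * A) deficit*γn≤g*A ⟩
        deficit x * A ∸ deficit x * γn  ≡⟨ *-distribˡ-∸ (deficit x) A γn ⟨
        deficit x * (A ∸ γn)            ∎
        where
        open ≤-Reasoning
        g : ℕ
        g = DD T f P (x ⊕ unit e) ∸ DD T f P x
        deficit-step : deficit (x ⊕ unit e) ≡ deficit x ∸ g
        deficit-step = trans (cong (length P * T ∸_) (sym (m+[n∸m]≡n (DD-mono (≤B-⊕ x (unit e)) P))))
                             (sym (∸-+-assoc (length P * T) (DD T f P x) g))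
        deficit*γn≤g*A : deficit x * γn ≤ g * A
        deficit*γn≤g*A = begin
          deficit x * γn    ≡⟨ *-comm (deficit x) γn ⟩
          γn * deficit x    ≤⟨ deficit-bound x y P blocks g greedy ⟩
          ‖ y ‖ * (γd * g)  ≡⟨ solve 3 (λ N c g → N :* (c :* g) := g :* (c :* N)) refl ‖ y ‖ γd g ⟩
          g * A             ∎

      decay : ∀ {x} → IGRun T f P x → deficit x * A ^ ‖ x ‖ ≤ deficit zeroB * (A ∸ γn) ^ ‖ x ‖
      decay start = subst (λ k → deficit zeroB * A ^ k ≤ deficit zeroB * (A ∸ γn) ^ k) (sym (norm-zero {m})) ≤-refl
      decay (step {x} e run _ greedy) rewrite norm-⊕-unit x e = begin
        deficit (x ⊕ unit e) * (A * A ^ j) ≡⟨ *-assoc (deficit (x ⊕ unit e)) A (A ^ j) ⟨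
        deficit (x ⊕ unit e) * A * A ^ j   ≤⟨ *-monoˡ-≤ (A ^ j) (contraction x e greedy) ⟩
        deficit x * B * A ^ j              ≡⟨ trans (*-assoc (deficit x) B (A ^ j)) (*-leftComm (deficit x) B (A ^ j)) ⟩
        B * (deficit x * A ^ j)            ≤⟨ *-monoʳ-≤ B (decay run) ⟩
        B * (deficit zeroB * B ^ j)        ≡⟨ *-leftComm B (deficit zeroB) (B ^ j) ⟩
        deficit zeroB * (B * B ^ j)        ∎
        where
        open ≤-Reasoning
        j : ℕ
        j = ‖ x ‖
        B : ℕ
        B = A ∸ γn

      runLength : 0 < γn → ∀ Q → length P * T ≤ 2 ^ Q → ∀ {x} → IGRun T f P x → ‖ x ‖ * γn ≤ (3 + 2 * Q) * A
      runLength γn>0 Q small start = subst (λ k → k * γn ≤ (3 + 2 * Q) * A) (sym (norm-zero {m})) z≤n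
      runLength γn>0 Q small (step {x} e run unblocked greedy) = begin
        ‖ x ⊕ unit e ‖ * γn  ≡⟨ cong (_* γn) (norm-⊕-unit x e) ⟩
        γn + ‖ x ‖ * γn      ≤⟨ +-mono-≤ γn≤A ‖x‖*γn≤ ⟩
        A + suc Q * (A + A)  ≡⟨ solve 2 (λ Q A → A :+ (con 1 :+ Q) :* (A :+ A) := (con 3 :+ con 2 :* Q) :* A) refl Q A ⟩
        (3 + 2 * Q) * A      ∎
        where
        open ≤-Reasoning
        j : ℕ
        j = ‖ x ‖
        B : ℕ
        B = A ∸ γn
        -- the last step started from an unblocked x, so deficit x ≥ 1; by the
        -- greedy-gain bound this forces ‖y‖ ≥ 1, hence γn ≤ A, and decayLength
        -- applies to the factorisation A = γn + (A − γn)
        1≤deficit : 1 ≤ deficit x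
        1≤deficit = m<n⇒0<n∸m unblocked
        instance
          ‖y‖≢0 : NonZero ‖ y ‖
          ‖y‖≢0 = m*n≢0⇒m≢0 ‖ y ‖ {{>-nonZero (≤-trans (*-mono-≤ γn>0 1≤deficit) (deficit-bound x y P blocks _ greedy))}}
          γn≢0 : NonZero γn
          γn≢0 = >-nonZero γn>0
        γn≤A : γn ≤ A
        γn≤A = ≤-trans γn≤γd (m≤m*n γd ‖ y ‖)
        γn+B≡A : γn + B ≡ A
        γn+B≡A = m+[n∸m]≡n γn≤A
        A^j≤deficit₀*B^j : (γn + B) ^ j ≤ deficit zeroB * B ^ j
        A^j≤deficit₀*B^j = subst (λ a → a ^ j ≤ deficit zeroB * B ^ j) (sym γn+B≡A)
                                 (≤-trans (m≤n*m (A ^ j) (deficit x) {{>-nonZero 1≤deficit}}) (decay run))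
        ‖x‖*γn≤ : j * γn ≤ suc Q * (A + A)
        ‖x‖*γn≤ = subst (λ a → j * γn ≤ suc Q * (a + a)) γn+B≡A
                        (decayLength γn B (deficit zeroB) j Q A^j≤deficit₀*B^j (≤-trans (m∸n≤m (length P * T) (DD T f P zeroB)) small))

-- A graph without parallel edges on n vertices has at most n² edges:
-- e ↦ (src e, tgt e) is an injection into Fin n × Fin n ≅ Fin (n * n).
edges≤n² : ∀ {n m} (src tgt : Fin m → Fin n) →
           (∀ e e' → src e ≡ src e' → tgt e ≡ tgt e' → e ≡ e') → m ≤ n * n
edges≤n² src tgt simple = injective⇒≤ {f = λ e → combine (src e) (tgt e)} endpoints-injective
  where
  endpoints-injective : ∀ {e e'} → combine (src e) (tgt e) ≡ combine (src e') (tgt e') → e ≡ e'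
  endpoints-injective {e} {e'} eq with combine-injective (src e) (tgt e) (src e') (tgt e') eq
  ... | src≡ , tgt≡ = simple e e' src≡ tgt≡

lookup-injective : ∀ {A : Set} {xs : List A} → Unique xs → ∀ {i j} → lookup xs i ≡ lookup xs j → i ≡ j
lookup-injective (x∉xs ∷ u) {zero}  {zero}  _  = refl
lookup-injective (x∉xs ∷ u) {zero}  {suc j} eq = contradiction eq (All.lookup x∉xs (∈-lookup j))
lookup-injective (x∉xs ∷ u) {suc i} {zero}  eq = contradiction (sym eq) (All.lookup x∉xs (∈-lookup i))
lookup-injective (x∉xs ∷ u) {suc i} {suc j} eq = cong suc (lookup-injective u eq)

unique-⊆-length : ∀ {A : Set} {xs ys : List A} → Unique xs → All (_∈ ys) xs → length xs ≤ length ys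
unique-⊆-length {xs = xs} {ys} u xs⊆ys = injective⇒≤ {f = position} position-injective
  where
  open ≡-Reasoning
  position : Fin (length xs) → Fin (length ys)
  position i = index (All.lookup xs⊆ys (∈-lookup i))
  position-injective : ∀ {i j} → position i ≡ position j → i ≡ j
  position-injective {i} {j} eq = lookup-injective u (begin
    lookup xs i            ≡⟨ lookup-index (All.lookup xs⊆ys (∈-lookup i)) ⟩
    lookup ys (position i) ≡⟨ cong (lookup ys) eq ⟩
    lookup ys (position j) ≡⟨ lookup-index (All.lookup xs⊆ys (∈-lookup j)) ⟨
    lookup xs j            ∎)

length-cartesianProductWith : ∀ {A B C : Set} (g : A → B → C) xs ys →
                              length (cartesianProductWith g xs ys) ≡ length xs * length ys
length-cartesianProductWith g []       ys = refl
length-cartesianProductWith g (x ∷ xs) ys =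
  trans (length-++ (map (g x) ys)) (cong₂ _+_ (length-map (g x) ys) (length-cartesianProductWith g xs ys))

sequences : ∀ m → ℕ → List (List (Fin m))
sequences m zero    = [] ∷ []
sequences m (suc k) = [] ∷ cartesianProductWith _∷_ (allFin m) (sequences m k)

∈-sequences : ∀ {m} k (p : List (Fin m)) → length p ≤ k → p ∈ sequences m k
∈-sequences zero    []      _          = here refl
∈-sequences (suc k) []      _          = here refl
∈-sequences (suc k) (e ∷ p) (s≤s p≤k) =
  there (∈-cartesianProductWith⁺ _∷_ (∈-allFin e) (∈-sequences k p p≤k))

length-sequences : ∀ m k → length (sequences m k) ≤ suc m ^ k
length-sequences m zero    = ≤-refl
length-sequences m (suc k) = begin
  suc (length (cartesianProductWith _∷_ (allFin m) (sequences m k)))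
    ≡⟨ cong suc (trans (length-cartesianProductWith _∷_ (allFin m) (sequences m k))
                       (cong (_* length (sequences m k)) (length-tabulate {n = m} (λ e → e)))) ⟩
  suc (m * length (sequences m k)) ≤⟨ s≤s (*-monoʳ-≤ m (length-sequences m k)) ⟩
  suc (m * N)                      ≤⟨ +-monoˡ-≤ (m * N) (m^n>0 (suc m) k) ⟩
  N + m * N                        ∎
  where
  open ≤-Reasoning
  N : ℕ
  N = suc m ^ k

-- A feasible path has fewer than h edges: |p| w ≤ Σ_{e∈p} f_e(0) < T ≤ h w.
feasible-short : ∀ {n m} {src tgt : Fin m → Fin n} {f : Fin m → ℕ → ℕ} {T S} (w h : ℕ) →
                 (∀ e → w ≤ f e 0) → T ≤ h * w → ∀ {p} → Feasible src tgt f T S p → length p < h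
feasible-short {f = f} w h w≤f T≤hw {p} (_ , _ , _ , _ , short) =
  *-cancelʳ-< w (length p) h (<-≤-trans (≤-<-trans (length*w≤pathLen p) short) T≤hw)
  where
  length*w≤pathLen : ∀ p → length p * w ≤ pathLen f zeroB p
  length*w≤pathLen []      = z≤n
  length*w≤pathLen (e ∷ p) = +-mono-≤ (w≤f e) (length*w≤pathLen p)

-- A nonempty vertex-simple path visits two distinct vertices, so a feasible
-- path that some budget y blocks (T ≤ ℓ_y(p)) lives in a graph with n ≥ 2.
blocked-feasible⇒2≤n : ∀ {n m} {src tgt : Fin m → Fin n} {f : Fin m → ℕ → ℕ} {T S} (y : Budget m) →
                       ∀ {p} → Feasible src tgt f T S p → T ≤ pathLen f y p → 2 ≤ n
blocked-feasible⇒2≤n y {[]}    (_ , _ , _ , _ , 0<T) T≤0 = contradiction (<-≤-trans 0<T T≤0) (<-irrefl refl)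
blocked-feasible⇒2≤n {src = src} {tgt} y {e ∷ p} (s , _ , _ , (_ , (s∉rest ∷ _)) , _) _ = distinct⇒2≤n (s≢head p s∉rest)
  where
  s≢head : ∀ {u} es → All (s ≢_) (verts src tgt u es) → s ≢ u
  s≢head []       (s≢u ∷ _) = s≢u
  s≢head (_ ∷ _)  (s≢u ∷ _) = s≢u
  distinct⇒2≤n : ∀ {n} {i j : Fin n} → i ≢ j → 2 ≤ n
  distinct⇒2≤n {suc zero}    {zero} {zero} i≢j = contradiction refl i≢j
  distinct⇒2≤n {suc (suc _)} _                  = s≤s (s≤s z≤n)

1≤⌈log₂n⌉ : ∀ n → 2 ≤ n → 1 ≤ ⌈log₂ n ⌉
1≤⌈log₂n⌉ n 2≤n with ⌈log₂ n ⌉ | n≤2^⌈log₂n⌉ n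
... | zero  | n≤1 = contradiction (≤-trans 2≤n n≤1) λ { (s≤s ()) }
... | suc _ | _   = s≤s z≤n

-- Size of a feasible family: with a = ⌈log₂ n⌉ ≥ 1 we have m + 1 ≤ n² + 1 ≤ 2^(3a),
-- so a duplicate-free family of feasible paths has at most 2^(3ah) members.
family-size : ∀ {n m} (src tgt : Fin m → Fin n) → (∀ e e' → src e ≡ src e' → tgt e ≡ tgt e' → e ≡ e') →
              (f : Fin m → ℕ → ℕ) (w : ℕ) → (∀ e → w ≤ f e 0) → (S : List (Fin n × Fin n)) (T h : ℕ) →
              T ≤ h * w → 2 ≤ n → (P : List (List (Fin m))) → Unique P → All (Feasible src tgt f T S) P →
              length P ≤ 2 ^ (3 * ⌈log₂ n ⌉ * h)
family-size {n} {m} src tgt simple f w w≤f S T h T≤hw 2≤n P uniq feas = begin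
  length P                  ≤⟨ unique-⊆-length uniq (All.map (λ fp → ∈-sequences h _ (<⇒≤ (feasible-short {f = f} w h w≤f T≤hw fp))) feas) ⟩
  length (sequences m h)    ≤⟨ length-sequences m h ⟩
  suc m ^ h                 ≤⟨ ^-monoˡ-≤ h 1+m≤2^3a ⟩
  (2 ^ (3 * a)) ^ h         ≡⟨ ^-*-assoc 2 (3 * a) h ⟩
  2 ^ (3 * a * h)           ∎
  where
  open ≤-Reasoning
  a : ℕ
  a = ⌈log₂ n ⌉
  1+m≤2^3a : suc m ≤ 2 ^ (3 * a)
  1+m≤2^3a = begin
    suc m                      ≤⟨ s≤s (≤-trans (edges≤n² src tgt simple) (*-mono-≤ (n≤2^⌈log₂n⌉ n) (n≤2^⌈log₂n⌉ n))) ⟩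
    suc (2 ^ a * 2 ^ a)        ≡⟨ cong suc (^-distribˡ-+-* 2 a a) ⟨
    suc (2 ^ (a + a))          ≤⟨ +-monoˡ-≤ (2 ^ (a + a)) (m^n>0 2 (a + a)) ⟩
    2 ^ (a + a) + 2 ^ (a + a)  ≡⟨ cong (2 ^ (a + a) +_) (+-identityʳ (2 ^ (a + a))) ⟨
    2 ^ suc (a + a)            ≤⟨ ^-monoʳ-≤ 2 (≤-trans (+-monoˡ-≤ (a + a) (1≤⌈log₂n⌉ n 2≤n))
                                                       (≤-reflexive (solve 1 (λ a → a :+ (a :+ a) := con 3 :* a) refl a))) ⟩
    2 ^ (3 * a)                ∎

empty-family-run : ∀ {m T} {f : Fin m → ℕ → ℕ} {x : Budget m} → IGRun T f [] x → ‖ x ‖ ≡ 0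
empty-family-run {m} start       = norm-zero {m}
empty-family-run (step _ _ () _)

constant≤10 : ∀ a h b → 1 ≤ h * a → 3 + 2 * (3 * a * h + b) ≤ 10 * (h * a + b)
constant≤10 a h b 1≤ha = begin
  3 + 2 * (3 * a * h + b)        ≡⟨ solve 3 (λ a h b → con 3 :+ con 2 :* (con 3 :* a :* h :+ b)
                                                      := con 3 :+ (con 6 :* (h :* a) :+ con 2 :* b)) refl a h b ⟩
  3 + (6 * (h * a) + 2 * b)      ≤⟨ +-monoˡ-≤ (6 * (h * a) + 2 * b) (*-monoʳ-≤ 3 1≤ha) ⟩
  3 * (h * a) + (6 * (h * a) + 2 * b) ≡⟨ solve 2 (λ H b → con 3 :* H :+ (con 6 :* H :+ con 2 :* b)
                                                      := con 9 :* H :+ con 2 :* b) refl (h * a) b ⟩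
  9 * (h * a) + 2 * b            ≤⟨ +-mono-≤ (*-monoˡ-≤ (h * a) (n≤1+n 9)) (*-monoˡ-≤ b (m≤m+n 2 8)) ⟩
  10 * (h * a) + 10 * b          ≡⟨ *-distribˡ-+ 10 (h * a) b ⟨
  10 * (h * a + b)               ∎
  where open ≤-Reasoning

-- For P = [] the output is 0; otherwise the first path of P is
-- blocked by y, so n ≥ 2 and h ≥ 1, |P| T ≤ 2^Q for Q = 3ah + ⌈log₂ T⌉, and the
-- run length estimate gives ‖x‖ γn ≤ (2Q + 3) γd ‖y‖.
approximation : ∀ {n m} (src tgt : Fin m → Fin n) → (∀ e e' → src e ≡ src e' → tgt e ≡ tgt e' → e ≡ e') →
    (f : Fin m → ℕ → ℕ) → (∀ e x y → x ≤ y → f e x ≤ f e y) →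
    (w : ℕ) → (∀ e → w ≤ f e 0) → (S : List (Fin n × Fin n)) (T h : ℕ) → T ≤ h * w →
    (γn γd : ℕ) → 0 < γn → γn ≤ γd →
    (∀ e x y → x ≤ y → γn * (f e (suc y) ∸ f e y) ≤ γd * (f e (suc x) ∸ f e x)) →
    (P : List (List (Fin m))) → Unique P → All (Feasible src tgt f T S) P →
    (y : Budget m) → Blocks T f P y → {x : Budget m} → IGRun T f P x →
    ‖ x ‖ * γn ≤ 10 * γd * (h * ⌈log₂ n ⌉ + ⌈log₂ T ⌉) * ‖ y ‖
approximation {n} src tgt simple f f-mono w w≤f S T h T≤hw γn γd γn>0 γn≤γd concave [] _ _ y _ run =
  subst (λ k → k * γn ≤ 10 * γd * (h * ⌈log₂ n ⌉ + ⌈log₂ T ⌉) * ‖ y ‖) (sym (empty-family-run run)) z≤n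
approximation {n} src tgt simple f f-mono w w≤f S T h T≤hw γn γd γn>0 γn≤γd concave
              P@(p ∷ P′) uniq feas@(p-feasible ∷ _) y blocks {x} run = begin
  ‖ x ‖ * γn                          ≤⟨ runLength γn>0 Q |P|T≤2^Q run ⟩
  (3 + 2 * Q) * A                     ≤⟨ *-monoˡ-≤ A (constant≤10 a h b 1≤ha) ⟩
  10 * (h * a + b) * (γd * ‖ y ‖)     ≡⟨ solve 3 (λ L c N → con 10 :* L :* (c :* N) := con 10 :* c :* L :* N) refl (h * a + b) γd ‖ y ‖ ⟩
  10 * γd * (h * a + b) * ‖ y ‖       ∎
  where
  open ≤-Reasoning
  open Coverage T f f-mono
  open WeakDiminishingReturns γn γd γn≤γd concave
  open Greedy P y blocks
  a : ℕ
  a = ⌈log₂ n ⌉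
  b : ℕ
  b = ⌈log₂ T ⌉
  Q : ℕ
  Q = 3 * a * h + b
  2≤n : 2 ≤ n
  2≤n = blocked-feasible⇒2≤n {f = f} y p-feasible (blocked-head y p P′ blocks)
  1≤ha : 1 ≤ h * a
  1≤ha = *-mono-≤ (≤-trans (s≤s z≤n) (feasible-short {f = f} w h w≤f T≤hw p-feasible)) (1≤⌈log₂n⌉ n 2≤n)
  |P|T≤2^Q : length P * T ≤ 2 ^ Q
  |P|T≤2^Q = ≤-trans (*-mono-≤ (family-size src tgt simple f w w≤f S T h T≤hw 2≤n P uniq feas) (n≤2^⌈log₂n⌉ T))
                     (≤-reflexive (sym (^-distribˡ-+-* 2 (3 * a * h) b)))

-- Theorem 4.4 with C = 10.
theorem4p4 : ∃[ C ] (∀ (n m : ℕ) (src tgt : Fin m → Fin n) →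
    (∀ e e' → src e ≡ src e' → tgt e ≡ tgt e' → e ≡ e') →
    (f : Fin m → ℕ → ℕ) → (∀ e → 0 < f e 0) → (∀ e x y → x ≤ y → f e x ≤ f e y) →
    (w : ℕ) → (∀ e → w ≤ f e 0) → ∃[ e ] (f e 0 ≡ w) →
    (b : Budget m) (S : List (Fin n × Fin n)) (T h : ℕ) →
    T ≤ h * w → (∀ k → T ≤ k * w → h ≤ k) →
    (γn γd : ℕ) → 0 < γn → γn ≤ γd →
    (∀ e x y → x ≤ y → γn * (f e (suc y) ∸ f e y) ≤ γd * (f e (suc x) ∸ f e x)) →
    (P : List (List (Fin m))) → Unique P → All (Feasible src tgt f T S) P →
    (y : Budget m) → (∀ e → y e ≤ b e) → Blocks T f P y →
    (x : Budget m) → IGRun T f P x →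
    ‖ x ‖ * γn ≤ C * γd * (h * ⌈log₂ n ⌉ + ⌈log₂ T ⌉) * ‖ y ‖)
theorem4p4 = 10 , λ n m src tgt simple f _ f-mono w w≤f _ _ S T h T≤hw _ γn γd γn>0 γn≤γd concave
                    P uniq feas y _ blocks x run →
  approximation src tgt simple f f-mono w w≤f S T h T≤hw γn γd γn>0 γn≤γd concave P uniq feas y blocks run
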